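{- For $w\in\mathfrak{S}_n$ that contains the pattern $3412$, $\mathrm{mh}(w)=\mathrm{mcontent}(w)$.
   Context: An occurrence of $3412$ in $w\in\mathfrak{S}_n$ is a choice of indices $a<b<c<d$ with $w(c)<w(d)<w(a)<w(b)$. Its height is $w(a)-w(d)$, and its content is $1+|\{i \mid b<i<c,\ w(d)<w(i)<w(a)\}|$. $\mathrm{mh}(w)$ and $\mathrm{mcontent}(w)$ are the minimum height and minimum content, respectively, over all occurrences of $3412$ in $w$. -}

module Defs where

open import Data.Nat using (ℕ; suc; _∸_; _≤_)
open import Data.Fin using (Fin; toℕ; _<_; _<?_)
open import Data.Fin.Permutation using (Permutation′; _⟨$⟩ʳ_)
open import Data.List using (List; length; filter)
open import Data.Product using (Σ; ∃; _×_; _,_)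
open import Relation.Nullary using (Dec)
open import Relation.Nullary.Decidable using (_×-dec_)
import Data.List as L
open import Relation.Binary.PropositionalEquality using (_≡_)

allFin : (n : ℕ) → List (Fin n)
allFin n = L.allFin n

record Occ3412 {n : ℕ} (w : Permutation′ n) : Set where
  constructor occ
  field
    a b c d : Fin n
    a<b : a < b
    b<c : b < c
    c<d : c < d
    wc<wd : (w ⟨$⟩ʳ c) < (w ⟨$⟩ʳ d)
    wd<wa : (w ⟨$⟩ʳ d) < (w ⟨$⟩ʳ a)
    wa<wb : (w ⟨$⟩ʳ a) < (w ⟨$⟩ʳ b)

module _ {n : ℕ} {w : Permutation′ n} where
  open Occ3412

  height : Occ3412 w → ℕ
  height o = toℕ (w ⟨$⟩ʳ a o) ∸ toℕ (w ⟨$⟩ʳ d o)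

  content : Occ3412 w → ℕ
  content o = suc (length (filter P? (allFin n)))
    where
    P? : (i : Fin n) → Dec ((b o < i × i < c o) × ((w ⟨$⟩ʳ d o) < (w ⟨$⟩ʳ i) × (w ⟨$⟩ʳ i) < (w ⟨$⟩ʳ a o)))
    P? i = ((b o <? i) ×-dec (i <? c o)) ×-dec (((w ⟨$⟩ʳ d o) <? (w ⟨$⟩ʳ i)) ×-dec ((w ⟨$⟩ʳ i) <? (w ⟨$⟩ʳ a o)))

Contains3412 : {n : ℕ} → Permutation′ n → Set
Contains3412 w = Occ3412 w

IsMinOver : {n : ℕ} (w : Permutation′ n) → (Occ3412 w → ℕ) → ℕ → Set
IsMinOver w f m = (Σ (Occ3412 w) λ o → f o ≡ m) × ((o : Occ3412 w) → m ≤ f o)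

IsMh : {n : ℕ} (w : Permutation′ n) → ℕ → Set
IsMh w m = IsMinOver w height m

IsMcontent : {n : ℕ} (w : Permutation′ n) → ℕ → Set
IsMcontent w m = IsMinOver w content m

-- Since w is a bijection, height − 1 counts all values strictly between w(d) and w(a),
-- while content − 1 counts only those lying between positions b and c.
-- A value in that range at a position left of b (right of c) can replace a (resp. d),
-- giving an occurrence of smaller height and no larger content. Hence an occurrence of
-- minimal height has all those values between b and c, so its content equals its height,
-- and descending from any occurrence shows that its content is at least the minimal height.
module Submission where

open import Defs
open import Data.Bool.Base using (true; false; if_then_else_)
open import Data.Nat.Base using (ℕ; zero; suc; _∸_; _≤_; z≤n; s≤s) renaming (_<_ to _<ℕ_)
open import Data.Nat.Properties
  using (≤-trans; ≤-reflexive; <⇒≤; ≮⇒≥; ≤⇒≯; ∸-monoˡ-<; ∸-monoʳ-<; +-0-commutativeMonoid)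
  renaming (_<?_ to _<ℕ?_)
open import Data.Nat.Induction using (<-wellFounded)
open import Data.Fin.Base using (Fin; toℕ; _<_)
open import Data.Fin.Properties using (_<?_; any?; toℕ<n; <-trans; <-asym; <-cmp)
open import Data.Fin.Permutation using (Permutation′; _⟨$⟩ʳ_)
open import Data.List.Base using (length; filter; tabulate)
open import Data.List.Properties using (filter-≐)
open import Data.List.Relation.Binary.Sublist.Propositional using (⊆-refl)
open import Data.List.Relation.Binary.Sublist.Propositional.Properties using (filter⁺; length-mono-≤)
open import Data.Product.Base using (Σ; ∃; _×_; _,_; proj₂)
open import Data.Sum.Base using (_⊎_; inj₁; inj₂)
open import Data.Empty using (⊥-elim)
open import Function.Base using (id)
open import Induction.WellFounded using (Acc; acc)
open import Level using (Level; 0ℓ)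
open import Relation.Binary.Definitions using (tri<; tri≈; tri>)
open import Relation.Binary.PropositionalEquality using (_≡_; refl; sym; cong; module ≡-Reasoning)
open import Relation.Nullary using (¬_)
open import Relation.Nullary.Decidable using (Dec; yes; no; does; map′; _×-dec_; ¬?; decidable-stable)
open import Relation.Unary using (Pred; Decidable; _⊆_)
open import Algebra.Properties.CommutativeMonoid.Sum +-0-commutativeMonoid using (sum-syntax; ∑-permute)

private
  variable
    ℓ p q : Level
    A : Set ℓ

argmin : (f : A → ℕ) → (∀ k → Dec (∃ λ x → f x <ℕ k)) → A → Σ A λ x → ∀ y → f x ≤ f y
argmin {A = A} f below? x = descend x (<-wellFounded (f x))
  where
  descend : ∀ x → Acc _<ℕ_ (f x) → Σ A λ x → ∀ y → f x ≤ f y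
  descend x (acc smaller) with below? (f x)
  ... | yes (y , fy<fx) = descend y (smaller fy<fx)
  ... | no ∄y           = x , λ y → ≮⇒≥ λ fy<fx → ∄y (y , fy<fx)

length-filter-mono : {P : Pred A p} {Q : Pred A q} (P? : Decidable P) (Q? : Decidable Q) →
                     P ⊆ Q → ∀ xs → length (filter P? xs) ≤ length (filter Q? xs)
length-filter-mono P? Q? P⊆Q xs = length-mono-≤ (filter⁺ P? Q? (λ { refl → P⊆Q }) (⊆-refl {x = xs}))

indicator : {P : Set p} → Dec P → ℕ
indicator P? = if does P? then 1 else 0

length-filter-tabulate : ∀ {n} {P : Pred A p} (P? : Decidable P) (f : Fin n → A) →
                         length (filter P? (tabulate f)) ≡ ∑[ i < n ] indicator (P? (f i))
length-filter-tabulate {n = zero}  P? f = refl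
length-filter-tabulate {n = suc n} P? f with does (P? (f Fin.zero))
... | true  = cong suc (length-filter-tabulate P? (λ i → f (Fin.suc i)))
... | false = length-filter-tabulate P? (λ i → f (Fin.suc i))

count-below : ∀ {n} v → v ≤ n → ∑[ j < n ] indicator (toℕ j <ℕ? v) ≡ v
count-below {zero}  zero    _         = refl
count-below {suc n} zero    _         = count-below {n} zero z≤n
count-below {suc n} (suc v) (s≤s v≤n) = cong suc (count-below v v≤n)

count-between : ∀ {n u v} → u <ℕ v → v ≤ n →
                suc (∑[ j < n ] indicator ((u <ℕ? toℕ j) ×-dec (toℕ j <ℕ? v))) ≡ v ∸ u
count-between {suc n} {zero}  {suc v} _         (s≤s v≤n) = cong suc (count-below v v≤n)
count-between {suc n} {suc u} {suc v} (s≤s u<v) (s≤s v≤n) = count-between u<v v≤n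

module _ {n : ℕ} (w : Permutation′ n) where
  open Occ3412

  IsOccurrence : (a b c d : Fin n) → Set
  IsOccurrence a b c d = a < b × b < c × c < d ×
                         w ⟨$⟩ʳ c < w ⟨$⟩ʳ d × w ⟨$⟩ʳ d < w ⟨$⟩ʳ a × w ⟨$⟩ʳ a < w ⟨$⟩ʳ b

  isOccurrence? : ∀ a b c d → Dec (IsOccurrence a b c d)
  isOccurrence? a b c d = a <? b ×-dec b <? c ×-dec c <? d ×-dec
                          w ⟨$⟩ʳ c <? w ⟨$⟩ʳ d ×-dec w ⟨$⟩ʳ d <? w ⟨$⟩ʳ a ×-dec w ⟨$⟩ʳ a <? w ⟨$⟩ʳ b

  ∃-occurrence? : {Q : (a b c d : Fin n) → Set} → (∀ a b c d → Dec (Q a b c d)) →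
                  Dec (∃ λ (o : Occ3412 w) → Q (a o) (b o) (c o) (d o))
  ∃-occurrence? {Q} Q? =
    map′ toOccurrence fromOccurrence
      (any? λ a → any? λ b → any? λ c → any? λ d → isOccurrence? a b c d ×-dec Q? a b c d)
    where
    toOccurrence : (∃ λ a → ∃ λ b → ∃ λ c → ∃ λ d → IsOccurrence a b c d × Q a b c d) →
                   ∃ λ (o : Occ3412 w) → Q (a o) (b o) (c o) (d o)
    toOccurrence (a , b , c , d , (a<b , b<c , c<d , wc<wd , wd<wa , wa<wb) , q) =
      occ a b c d a<b b<c c<d wc<wd wd<wa wa<wb , q
    fromOccurrence : (∃ λ (o : Occ3412 w) → Q (a o) (b o) (c o) (d o)) →
                     ∃ λ a → ∃ λ b → ∃ λ c → ∃ λ d → IsOccurrence a b c d × Q a b c d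
    fromOccurrence (o , q) =
      a o , b o , c o , d o , (a<b o , b<c o , c<d o , wc<wd o , wd<wa o , wa<wb o) , q

  ∃-height<? : ∀ k → Dec (∃ λ (o : Occ3412 w) → height o <ℕ k)
  ∃-height<? k = ∃-occurrence? λ a _ _ d → toℕ (w ⟨$⟩ʳ a) ∸ toℕ (w ⟨$⟩ʳ d) <ℕ? k

  BetweenPositions : Occ3412 w → Pred (Fin n) 0ℓ
  BetweenPositions o i = b o < i × i < c o

  BetweenValues : Occ3412 w → Pred (Fin n) 0ℓ
  BetweenValues o i = w ⟨$⟩ʳ d o < w ⟨$⟩ʳ i × w ⟨$⟩ʳ i < w ⟨$⟩ʳ a o

  betweenPositions? : ∀ o → Decidable (BetweenPositions o)
  betweenPositions? o i = b o <? i ×-dec i <? c o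

  betweenValues? : ∀ o → Decidable (BetweenValues o)
  betweenValues? o i = w ⟨$⟩ʳ d o <? w ⟨$⟩ʳ i ×-dec w ⟨$⟩ʳ i <? w ⟨$⟩ʳ a o

  suc-count-betweenValues : ∀ o → suc (length (filter (betweenValues? o) (allFin n))) ≡ height o
  suc-count-betweenValues o = begin
    suc (length (filter (betweenValues? o) (allFin n)))    ≡⟨ cong suc (length-filter-tabulate (betweenValues? o) id) ⟩
    suc (∑[ i < n ] inWindow (w ⟨$⟩ʳ i))                   ≡⟨ cong suc (∑-permute inWindow w) ⟨
    suc (∑[ j < n ] inWindow j)                            ≡⟨ count-between (wd<wa o) (<⇒≤ (toℕ<n (w ⟨$⟩ʳ a o))) ⟩
    height o                                               ∎
    where
    open ≡-Reasoning
    inWindow : Fin n → ℕ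
    inWindow j = indicator (toℕ (w ⟨$⟩ʳ d o) <ℕ? toℕ j ×-dec toℕ j <ℕ? toℕ (w ⟨$⟩ʳ a o))

  Tight : Occ3412 w → Set
  Tight o = BetweenValues o ⊆ BetweenPositions o

  tight⇒content≡height : ∀ o → Tight o → content o ≡ height o
  tight⇒content≡height o tight = begin
    content o                                            ≡⟨ cong (λ xs → suc (length xs)) window≡values ⟩
    suc (length (filter (betweenValues? o) (allFin n)))  ≡⟨ suc-count-betweenValues o ⟩
    height o                                             ∎
    where
    open ≡-Reasoning
    window≡values : filter (λ i → betweenPositions? o i ×-dec betweenValues? o i) (allFin n)
                  ≡ filter (betweenValues? o) (allFin n)
    window≡values = filter-≐ _ (betweenValues? o) (proj₂ , λ v → tight v , v) (allFin n)

  Smaller : Occ3412 w → Set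
  Smaller o = Σ (Occ3412 w) λ o′ → height o′ <ℕ height o × content o′ ≤ content o

  shrink : ∀ o {i} → BetweenValues o i → ¬ BetweenPositions o i → Smaller o
  shrink o {i} (wd<wi , wi<wa) i∉ with <-cmp i (b o) | <-cmp i (c o)
  ... | tri< i<b _ _ | _ =
    occ i (b o) (c o) (d o) i<b (b<c o) (c<d o) (wc<wd o) wd<wi (<-trans wi<wa (wa<wb o)) ,
    ∸-monoˡ-< wi<wa (<⇒≤ wd<wi) ,
    s≤s (length-filter-mono _ _ (λ (pos , wd<wj , wj<wi) → pos , wd<wj , <-trans wj<wi wi<wa) (allFin n))
  ... | tri≈ _ refl _ | _ = ⊥-elim (<-asym wi<wa (wa<wb o))
  ... | tri> _ _ b<i | tri< i<c _ _ = ⊥-elim (i∉ (b<i , i<c))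
  ... | tri> _ _ _ | tri≈ _ refl _ = ⊥-elim (<-asym wd<wi (wc<wd o))
  ... | tri> _ _ _ | tri> _ _ c<i =
    occ (a o) (b o) (c o) i (a<b o) (b<c o) c<i (<-trans (wc<wd o) wd<wi) wi<wa (wa<wb o) ,
    ∸-monoʳ-< wd<wi (<⇒≤ wi<wa) ,
    s≤s (length-filter-mono _ _ (λ (pos , wi<wj , wj<wa) → pos , <-trans wd<wi wi<wj , wj<wa) (allFin n))

  tight-or-smaller : ∀ o → Tight o ⊎ Smaller o
  tight-or-smaller o with any? (λ i → betweenValues? o i ×-dec ¬? (betweenPositions? o i))
  ... | yes (i , inValues , ∉positions) = inj₂ (shrink o inValues ∉positions)
  ... | no ∄i = inj₁ λ {i} inValues →
    decidable-stable (betweenPositions? o i) λ ∉positions → ∄i (i , inValues , ∉positions)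

  height-minimal⇒tight : ∀ o → (∀ o′ → height o ≤ height o′) → Tight o
  height-minimal⇒tight o minimal with tight-or-smaller o
  ... | inj₁ tight           = tight
  ... | inj₂ (o′ , o′<o , _) = ⊥-elim (≤⇒≯ (minimal o′) o′<o)

  height-lower-bound⇒content-lower-bound : ∀ {m} → (∀ o → m ≤ height o) → ∀ o → m ≤ content o
  height-lower-bound⇒content-lower-bound {m} m≤height o = bound o (<-wellFounded (height o))
    where
    bound : ∀ o → Acc _<ℕ_ (height o) → m ≤ content o
    bound o (acc smaller) with tight-or-smaller o
    ... | inj₁ tight = ≤-trans (m≤height o) (≤-reflexive (sym (tight⇒content≡height o tight)))
    ... | inj₂ (o′ , o′<o , o′≤o) = ≤-trans (bound o′ (smaller o′<o)) o′≤o

lemma3p9 : (n : ℕ) (w : Permutation′ n) → Contains3412 w → ∃ λ m → IsMh w m × IsMcontent w m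
lemma3p9 n w o₀ with argmin height (∃-height<? w) o₀
... | o , minimal =
  height o ,
  ((o , refl) , minimal) ,
  ((o , tight⇒content≡height w o (height-minimal⇒tight w o minimal)) ,
   height-lower-bound⇒content-lower-bound w minimal)
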